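{- Let $F$ and $F'$ be finite sets, $\mathsf{M}$ a matroid on $F$, $\mathsf{M}'$ a matroid on $F'$, and $\phi\colon F\to F'$ a morphism of matroids from $\mathsf{M}$ to $\mathsf{M}'$ such that $\phi(F)$ spans $\mathsf{M}'$. Let $Q$ be a finite set of size $r=\operatorname{rk}\mathsf{M}$, disjoint from $F$, and $\widetilde F=Q\sqcup F$. Then the collection of subsets $\widetilde B\subseteq\widetilde F$ with $|\widetilde B|=\operatorname{rk}\mathsf{M}$ such that $\widetilde B\cap F$ is a basis of $\phi$ is the set of bases of a matroid on $\widetilde F$.
   Context: A map $\phi\colon F\to F'$ is a morphism of matroids from $\mathsf{M}$ to $\mathsf{M}'$ if for all $T_1\subseteq T_2\subseteq F$, $r_{\mathsf{M}'}(\phi(T_2))-r_{\mathsf{M}'}(\phi(T_1))\le r_{\mathsf{M}}(T_2)-r_{\mathsf{M}}(T_1)$. A subset $T\subseteq F$ is a basis of $\phi$ if $T$ is contained in a basis of $\mathsf{M}$ and $\phi(T)$ contains a basis of $\mathsf{M}'$. -}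

module Defs where

open import Data.Nat using (ℕ; _+_; _≤_)
open import Data.Bool using (Bool)
open import Data.Fin using (Fin; _≟_)
open import Data.Fin.Subset using (Subset; _∈_; _⊆_; _∪_; _∩_; ∣_∣; ⊤)
open import Data.Fin.Subset.Properties using (_∈?_)
open import Data.Fin.Properties using (any?)
open import Data.Vec using (tabulate)
open import Data.Product using (_×_; ∃)
open import Relation.Binary.PropositionalEquality using (_≡_)
open import Relation.Nullary.Decidable using (⌊_⌋; _×-dec_)

record Matroid (n : ℕ) : Set where
  field
    rank        : Subset n → ℕ
    rank-bound  : ∀ X → rank X ≤ ∣ X ∣
    rank-mono   : ∀ X Y → X ⊆ Y → rank X ≤ rank Y
    rank-submod : ∀ X Y → rank (X ∪ Y) + rank (X ∩ Y) ≤ rank X + rank Y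

open Matroid public

rk : ∀ {n} → Matroid n → ℕ
rk M = rank M ⊤

Independent : ∀ {n} → Matroid n → Subset n → Set
Independent M X = rank M X ≡ ∣ X ∣

IsBasis : ∀ {n} → Matroid n → Subset n → Set
IsBasis M X = Independent M X × (∀ Y → X ⊆ Y → Independent M Y → Y ⊆ X)

Spans : ∀ {n} → Matroid n → Subset n → Set
Spans M S = rank M S ≡ rk M

image : ∀ {n m} → (Fin n → Fin m) → Subset n → Subset m
image φ T = tabulate (λ j → ⌊ any? (λ i → (i ∈? T) ×-dec (φ i ≟ j)) ⌋)

-- morphism of matroids:  r'(φ T₂) − r'(φ T₁) ≤ r(T₂) − r(T₁)  for T₁ ⊆ T₂,
-- written additively to avoid truncated subtraction on ℕ.
IsMorphism : ∀ {n m} → Matroid n → Matroid m → (Fin n → Fin m) → Set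
IsMorphism M M' φ =
  ∀ T₁ T₂ → T₁ ⊆ T₂ →
    rank M' (image φ T₂) + rank M T₁ ≤ rank M T₂ + rank M' (image φ T₁)

BasisOf : ∀ {n m} → Matroid n → Matroid m → (Fin n → Fin m) → Subset n → Set
BasisOf M M' φ T =
  (∃ λ B → IsBasis M B × T ⊆ B) × (∃ λ B' → IsBasis M' B' × B' ⊆ image φ T)

-- On F̃ = Q ⊔ F the candidate rank function is
--   r̃(X) = min (|X ∩ Q| + r(X ∩ F), (rk M − rk M') + r'(φ(X ∩ F))).
-- Both arguments of the min are monotone and submodular, and along X ⊆ Y the second grows
-- no faster than the first (this is the morphism condition), which makes the min submodular
-- too; so r̃ is the rank function of a matroid. As φ(F) spans M', rk M' ≤ rk M and r̃(F̃) = rk M.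
-- A set B̃ of size rk M is then independent exactly when B̃ ∩ F is independent in M and
-- φ(B̃ ∩ F) spans M', i.e. when B̃ ∩ F is a basis of φ.
module Submission where

open import Defs
open import Data.Nat using (ℕ; zero; suc; _+_; _∸_; _⊓_; _≤_) renaming (_≟_ to _≟ℕ_)
open import Data.Nat.Properties hiding (_≟_)
open import Data.Nat.Tactic.RingSolver using (solve-∀)
open import Algebra.Properties.CommutativeSemigroup +-commutativeSemigroup using (interchange)
open import Data.Bool using (true; false; _∨_; _∧_)
open import Data.Fin using (Fin; _≟_)
open import Data.Fin.Properties using (any?)
open import Data.Fin.Subset
open import Data.Fin.Subset.Properties
open import Data.List using (List; []; _∷_; map; filter; allFin)
open import Data.List.Membership.Propositional.Properties using (∈-filter⁺; ∈-filter⁻; ∈-allFin)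
open import Data.List.Relation.Unary.All as All using (All; []; _∷_)
open import Data.List.Relation.Unary.Any using (here; there)
open import Data.Vec using ([]; _∷_; here; take; drop)
open import Data.Vec.Properties using (take-zipWith; drop-zipWith; lookup⇒[]=; []=⇒lookup; lookup∘tabulate)
open import Data.Product using (Σ-syntax; ∃; _×_; _,_; proj₁; proj₂)
open import Data.Product.Function.NonDependent.Propositional using (_×-⇔_)
open import Data.Sum using (inj₁; inj₂)
open import Function.Bundles using (_⇔_; mk⇔; Equivalence)
open Equivalence using (to; from)
open import Function.Properties.Equivalence using (⇔-isEquivalence)
open import Relation.Binary.Structures using (IsEquivalence)
open import Relation.Binary.PropositionalEquality
open import Relation.Nullary using (¬_; yes; no; contradiction)
open import Relation.Nullary.Decidable using (⌊_⌋; _×-dec_)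
import Data.List.Membership.Propositional as List

∣p∪q∣+∣p∩q∣≡∣p∣+∣q∣ : ∀ {n} (p q : Subset n) → ∣ p ∪ q ∣ + ∣ p ∩ q ∣ ≡ ∣ p ∣ + ∣ q ∣
∣p∪q∣+∣p∩q∣≡∣p∣+∣q∣ []          []          = refl
∣p∪q∣+∣p∩q∣≡∣p∣+∣q∣ (true ∷ p)  (true ∷ q)  =
  cong suc (trans (+-suc _ _) (trans (cong suc (∣p∪q∣+∣p∩q∣≡∣p∣+∣q∣ p q)) (sym (+-suc _ _))))
∣p∪q∣+∣p∩q∣≡∣p∣+∣q∣ (true ∷ p)  (false ∷ q) = cong suc (∣p∪q∣+∣p∩q∣≡∣p∣+∣q∣ p q)
∣p∪q∣+∣p∩q∣≡∣p∣+∣q∣ (false ∷ p) (true ∷ q)  = trans (cong suc (∣p∪q∣+∣p∩q∣≡∣p∣+∣q∣ p q)) (sym (+-suc _ _))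
∣p∪q∣+∣p∩q∣≡∣p∣+∣q∣ (false ∷ p) (false ∷ q) = ∣p∪q∣+∣p∩q∣≡∣p∣+∣q∣ p q

p⊆q⇒∣p∣+∣q─p∣≡∣q∣ : ∀ {n} {p q : Subset n} → p ⊆ q → ∣ p ∣ + ∣ q ─ p ∣ ≡ ∣ q ∣
p⊆q⇒∣p∣+∣q─p∣≡∣q∣ {p = []}        {[]}        _ = refl
p⊆q⇒∣p∣+∣q─p∣≡∣q∣ {p = true ∷ p}  {true ∷ q}  h = cong suc (p⊆q⇒∣p∣+∣q─p∣≡∣q∣ (drop-∷-⊆ h))
p⊆q⇒∣p∣+∣q─p∣≡∣q∣ {p = true ∷ p}  {false ∷ q} h with () ← h here
p⊆q⇒∣p∣+∣q─p∣≡∣q∣ {p = false ∷ p} {true ∷ q}  h = trans (+-suc _ _) (cong suc (p⊆q⇒∣p∣+∣q─p∣≡∣q∣ (drop-∷-⊆ h)))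
p⊆q⇒∣p∣+∣q─p∣≡∣q∣ {p = false ∷ p} {false ∷ q} h = p⊆q⇒∣p∣+∣q─p∣≡∣q∣ (drop-∷-⊆ h)

p⊆q∧∣q∣≤∣p∣⇒q⊆p : ∀ {n} {p q : Subset n} → p ⊆ q → ∣ q ∣ ≤ ∣ p ∣ → q ⊆ p
p⊆q∧∣q∣≤∣p∣⇒q⊆p {p = p} p⊆q ∣q∣≤∣p∣ {x} x∈q with x ∈? p
... | yes x∈p = x∈p
... | no  x∉p = contradiction (p⊂q⇒∣p∣<∣q∣ (p⊆q , x , x∈q , x∉p)) (≤⇒≯ ∣q∣≤∣p∣)

∣p∪⁅x⁆∣≤1+∣p∣ : ∀ {n} (p : Subset n) x → ∣ p ∪ ⁅ x ⁆ ∣ ≤ suc ∣ p ∣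
∣p∪⁅x⁆∣≤1+∣p∣ p x = begin
  ∣ p ∪ ⁅ x ⁆ ∣                   ≤⟨ m≤m+n _ _ ⟩
  ∣ p ∪ ⁅ x ⁆ ∣ + ∣ p ∩ ⁅ x ⁆ ∣   ≡⟨ ∣p∪q∣+∣p∩q∣≡∣p∣+∣q∣ p ⁅ x ⁆ ⟩
  ∣ p ∣ + ∣ ⁅ x ⁆ ∣               ≡⟨ cong (∣ p ∣ +_) (∣⁅x⁆∣≡1 x) ⟩
  ∣ p ∣ + 1                       ≡⟨ +-comm _ 1 ⟩
  suc ∣ p ∣                       ∎
  where open ≤-Reasoning

q⊆p∪[q─p] : ∀ {n} (p q : Subset n) → q ⊆ p ∪ (q ─ p)
q⊆p∪[q─p] p q {x} x∈q with x ∈? p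
... | yes x∈p = x∈p∪q⁺ (inj₁ x∈p)
... | no  x∉p = x∈p∪q⁺ (inj₂ (x∈p∧x∉q⇒x∈p─q x∈q x∉p))

∪-lub : ∀ {n} {p q r : Subset n} → p ⊆ r → q ⊆ r → p ∪ q ⊆ r
∪-lub {p = p} {q} p⊆r q⊆r x∈p∪q with x∈p∪q⁻ p q x∈p∪q
... | inj₁ x∈p = p⊆r x∈p
... | inj₂ x∈q = q⊆r x∈q

∩-glb : ∀ {n} {p q r : Subset n} → r ⊆ p → r ⊆ q → r ⊆ p ∩ q
∩-glb r⊆p r⊆q x∈r = x∈p∩q⁺ (r⊆p x∈r , r⊆q x∈r)

x∈⋃⁅L⁆ : ∀ {n} {x : Fin n} {L} → x List.∈ L → x ∈ ⋃ (map ⁅_⁆ L)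
x∈⋃⁅L⁆ {x = x} {y ∷ L} (here refl) = p⊆p∪q (⋃ (map ⁅_⁆ L)) (x∈⁅x⁆ x)
x∈⋃⁅L⁆ {x = x} {y ∷ L} (there x∈L) = q⊆p∪q ⁅ y ⁆ _ (x∈⋃⁅L⁆ x∈L)

∣p∣≡∣take∣+∣drop∣ : ∀ r {n} (p : Subset (r + n)) → ∣ p ∣ ≡ ∣ take r p ∣ + ∣ drop r p ∣
∣p∣≡∣take∣+∣drop∣ zero      p          = refl
∣p∣≡∣take∣+∣drop∣ (suc r)   (true ∷ p)  = cong suc (∣p∣≡∣take∣+∣drop∣ r p)
∣p∣≡∣take∣+∣drop∣ (suc r)   (false ∷ p) = ∣p∣≡∣take∣+∣drop∣ r p

take-⊤ : ∀ r {n} → take r (⊤ {r + n}) ≡ ⊤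
take-⊤ zero    = refl
take-⊤ (suc r) = cong (true ∷_) (take-⊤ r)

drop-⊤ : ∀ r {n} → drop r (⊤ {r + n}) ≡ ⊤
drop-⊤ zero    = refl
drop-⊤ (suc r) = drop-⊤ r

take-⊆ : ∀ r {n} {p q : Subset (r + n)} → p ⊆ q → take r p ⊆ take r q
take-⊆ zero    h ()
take-⊆ (suc r) {p = false ∷ p} {_ ∷ q}    h = out⊆ (take-⊆ r (drop-∷-⊆ h))
take-⊆ (suc r) {p = true ∷ p}  {true ∷ q} h = in⊆in (take-⊆ r (drop-∷-⊆ h))
take-⊆ (suc r) {p = true ∷ p}  {false ∷ q} h with () ← h here

drop-⊆ : ∀ r {n} {p q : Subset (r + n)} → p ⊆ q → drop r p ⊆ drop r q
drop-⊆ zero    h = h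
drop-⊆ (suc r) {p = _ ∷ p} {_ ∷ q} h = drop-⊆ r (drop-∷-⊆ h)

module _ {n m} (φ : Fin n → Fin m) where

  image-∈⁺ : ∀ {T i} → i ∈ T → φ i ∈ image φ T
  image-∈⁺ {T} {i} i∈T = lookup⇒[]= (φ i) (image φ T) (trans (lookup∘tabulate _ (φ i)) witnessed)
    where
    witnessed : ⌊ any? (λ k → (k ∈? T) ×-dec (φ k ≟ φ i)) ⌋ ≡ true
    witnessed with any? (λ k → (k ∈? T) ×-dec (φ k ≟ φ i))
    ... | yes _ = refl
    ... | no ∄ = contradiction (i , i∈T , refl) ∄

  image-∈⁻ : ∀ {T j} → j ∈ image φ T → ∃ λ i → i ∈ T × φ i ≡ j
  image-∈⁻ {T} {j} j∈φT = witness (trans (sym (lookup∘tabulate _ j)) ([]=⇒lookup j∈φT))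
    where
    witness : ⌊ any? (λ k → (k ∈? T) ×-dec (φ k ≟ j)) ⌋ ≡ true → ∃ λ i → i ∈ T × φ i ≡ j
    witness eq with any? (λ k → (k ∈? T) ×-dec (φ k ≟ j))
    ... | yes found = found
    witness () | no _

  image-mono : ∀ {A B} → A ⊆ B → image φ A ⊆ image φ B
  image-mono A⊆B j∈φA with image-∈⁻ j∈φA
  ... | i , i∈A , refl = image-∈⁺ (A⊆B i∈A)

  image-∪ : ∀ A B → image φ (A ∪ B) ⊆ image φ A ∪ image φ B
  image-∪ A B j∈ with image-∈⁻ j∈
  ... | i , i∈A∪B , refl with x∈p∪q⁻ A B i∈A∪B
  ...   | inj₁ i∈A = x∈p∪q⁺ (inj₁ (image-∈⁺ i∈A))
  ...   | inj₂ i∈B = x∈p∪q⁺ (inj₂ (image-∈⁺ i∈B))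

  image-∩ : ∀ A B → image φ (A ∩ B) ⊆ image φ A ∩ image φ B
  image-∩ A B = ∩-glb (image-mono (p∩q⊆p A B)) (image-mono (p∩q⊆q A B))

  image-⊥ : image φ ⊥ ⊆ ⊥
  image-⊥ j∈ with image-∈⁻ j∈
  ... | i , i∈⊥ , _ = contradiction i∈⊥ ∉⊥

module _ {n} (M : Matroid n) where
  private
    R = rank M

  rank-⊆ : ∀ {X Y} → X ⊆ Y → R X ≤ R Y
  rank-⊆ = rank-mono M _ _

  rank-⊥ : R ⊥ ≡ 0
  rank-⊥ = n≤0⇒n≡0 (subst (R ⊥ ≤_) (∣⊥∣≡0 n) (rank-bound M ⊥))

  independent-⊥ : Independent M ⊥
  independent-⊥ = trans rank-⊥ (sym (∣⊥∣≡0 n))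

  independent-⊆ : ∀ {X Y} → X ⊆ Y → Independent M Y → Independent M X
  independent-⊆ {X} {Y} X⊆Y indY = ≤-antisym (rank-bound M X) (+-cancelʳ-≤ ∣ Y ─ X ∣ _ _ (begin
    ∣ X ∣ + ∣ Y ─ X ∣            ≡⟨ p⊆q⇒∣p∣+∣q─p∣≡∣q∣ X⊆Y ⟩
    ∣ Y ∣                        ≡⟨ sym indY ⟩
    R Y                          ≤⟨ rank-⊆ (q⊆p∪[q─p] X Y) ⟩
    R (X ∪ (Y ─ X))              ≤⟨ m≤m+n _ _ ⟩
    R (X ∪ (Y ─ X)) + R (X ∩ (Y ─ X)) ≤⟨ rank-submod M X (Y ─ X) ⟩
    R X + R (Y ─ X)              ≤⟨ +-monoʳ-≤ (R X) (rank-bound M (Y ─ X)) ⟩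
    R X + ∣ Y ─ X ∣              ∎))
    where open ≤-Reasoning

  _⊆cl_ : Subset n → Subset n → Set
  A ⊆cl J = R (J ∪ A) ≤ R J

  ⊆cl-⊆ : ∀ {A B J} → A ⊆ B → B ⊆cl J → A ⊆cl J
  ⊆cl-⊆ A⊆B = ≤-trans (rank-⊆ (∪-lub (p⊆p∪q _) (⊆-trans A⊆B (q⊆p∪q _ _))))

  ⊆cl-⊥ : ∀ {J} → ⊥ ⊆cl J
  ⊆cl-⊥ = rank-⊆ (∪-lub ⊆-refl ⊥⊆)

  ⊆cl-∪ : ∀ {A B J} → A ⊆cl J → B ⊆cl J → (A ∪ B) ⊆cl J
  ⊆cl-∪ {A} {B} {J} A⊆clJ B⊆clJ = +-cancelʳ-≤ (R J) _ _ (begin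
    R (J ∪ (A ∪ B)) + R J                         ≤⟨ +-mono-≤ (rank-⊆ J∪[A∪B]⊆) (rank-⊆ (∩-glb (p⊆p∪q A) (p⊆p∪q B))) ⟩
    R ((J ∪ A) ∪ (J ∪ B)) + R ((J ∪ A) ∩ (J ∪ B)) ≤⟨ rank-submod M _ _ ⟩
    R (J ∪ A) + R (J ∪ B)                         ≤⟨ +-mono-≤ A⊆clJ B⊆clJ ⟩
    R J + R J                                     ∎)
    where
    open ≤-Reasoning
    J∪[A∪B]⊆ : J ∪ (A ∪ B) ⊆ (J ∪ A) ∪ (J ∪ B)
    J∪[A∪B]⊆ = ∪-lub (⊆-trans (p⊆p∪q A) (p⊆p∪q _))
                     (∪-lub (⊆-trans (q⊆p∪q J A) (p⊆p∪q _)) (⊆-trans (q⊆p∪q J B) (q⊆p∪q _ _)))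

  ⊆cl-mono : ∀ {A J J'} → J ⊆ J' → A ⊆cl J → A ⊆cl J'
  ⊆cl-mono {A} {J} {J'} J⊆J' A⊆clJ = +-cancelʳ-≤ (R J) _ _ (begin
    R (J' ∪ A) + R J                              ≤⟨ +-mono-≤ (rank-⊆ J'∪A⊆) (rank-⊆ (∩-glb J⊆J' (p⊆p∪q A))) ⟩
    R (J' ∪ (J ∪ A)) + R (J' ∩ (J ∪ A))           ≤⟨ rank-submod M J' (J ∪ A) ⟩
    R J' + R (J ∪ A)                              ≤⟨ +-monoʳ-≤ (R J') A⊆clJ ⟩
    R J' + R J                                    ∎)
    where
    open ≤-Reasoning
    J'∪A⊆ : J' ∪ A ⊆ J' ∪ (J ∪ A)
    J'∪A⊆ = ∪-lub (p⊆p∪q _) (⊆-trans (q⊆p∪q J A) (q⊆p∪q J' _))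

  ⋃-⊆cl : ∀ {J} L → All (λ e → ⁅ e ⁆ ⊆cl J) L → ⋃ (map ⁅_⁆ L) ⊆cl J
  ⋃-⊆cl []      []        = ⊆cl-⊥
  ⋃-⊆cl (e ∷ L) (e∈cl ∷ L⊆cl) = ⊆cl-∪ e∈cl (⋃-⊆cl L L⊆cl)

  ⊆cl-pointwise : ∀ {J S} → (∀ {e} → e ∈ S → ⁅ e ⁆ ⊆cl J) → S ⊆cl J
  ⊆cl-pointwise {J} {S} pointwise =
    ⊆cl-⊆ (λ {x} x∈S → x∈⋃⁅L⁆ (∈-filter⁺ (_∈? S) (∈-allFin x) x∈S))
          (⋃-⊆cl L (All.tabulate (λ e∈L → pointwise (proj₂ (∈-filter⁻ (_∈? S) {xs = allFin n} e∈L)))))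
    where L = filter (_∈? S) (allFin n)

  dependent⇒⊆cl : ∀ {J e} → Independent M J → ¬ Independent M (J ∪ ⁅ e ⁆) → ⁅ e ⁆ ⊆cl J
  dependent⇒⊆cl {J} {e} indJ dep = ≤-pred (begin-strict
    R (J ∪ ⁅ e ⁆)  <⟨ ≤∧≢⇒< (rank-bound M _) dep ⟩
    ∣ J ∪ ⁅ e ⁆ ∣  ≤⟨ ∣p∪⁅x⁆∣≤1+∣p∣ J e ⟩
    suc ∣ J ∣      ≡⟨ cong suc (sym indJ) ⟩
    suc (R J)      ∎)
    where open ≤-Reasoning

  extend-along : ∀ (L : List (Fin n)) {S J} → Independent M J → J ⊆ S →
    Σ[ J' ∈ Subset n ] (J ⊆ J' × J' ⊆ S × Independent M J' × All (λ e → e ∈ S → ⁅ e ⁆ ⊆cl J') L)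
  extend-along []      {S} {J} indJ J⊆S = J , ⊆-refl , J⊆S , indJ , []
  extend-along (e ∷ L) {S} {J} indJ J⊆S with e ∈? S | R (J ∪ ⁅ e ⁆) ≟ℕ ∣ J ∪ ⁅ e ⁆ ∣
  ... | yes e∈S | yes indJe =
    let J' , Je⊆J' , J'⊆S , indJ' , L⊆cl = extend-along L indJe (∪-lub J⊆S ⁅e⁆⊆S)
    in J' , ⊆-trans (p⊆p∪q _) Je⊆J' , J'⊆S , indJ' ,
       (λ _ → rank-⊆ (∪-lub ⊆-refl (⊆-trans (q⊆p∪q J _) Je⊆J'))) ∷ L⊆cl
    where
    ⁅e⁆⊆S : ⁅ e ⁆ ⊆ S
    ⁅e⁆⊆S x∈⁅e⁆ = subst (_∈ S) (sym (x∈⁅y⁆⇒x≡y e x∈⁅e⁆)) e∈S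
  ... | yes e∈S | no depJe =
    let J' , J⊆J' , J'⊆S , indJ' , L⊆cl = extend-along L indJ J⊆S
    in J' , J⊆J' , J'⊆S , indJ' , (λ _ → ⊆cl-mono J⊆J' (dependent⇒⊆cl indJ depJe)) ∷ L⊆cl
  ... | no e∉S | _ =
    let J' , J⊆J' , J'⊆S , indJ' , L⊆cl = extend-along L indJ J⊆S
    in J' , J⊆J' , J'⊆S , indJ' , (λ e∈S → contradiction e∈S e∉S) ∷ L⊆cl

  extend-within : ∀ {I S} → Independent M I → I ⊆ S →
    Σ[ J ∈ Subset n ] (I ⊆ J × J ⊆ S × Independent M J × R J ≡ R S)
  extend-within indI I⊆S =
    let J , I⊆J , J⊆S , indJ , all⊆cl = extend-along (allFin n) indI I⊆S
    in J , I⊆J , J⊆S , indJ ,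
       ≤-antisym (rank-⊆ J⊆S)
         (≤-trans (rank-⊆ (q⊆p∪q J _)) (⊆cl-pointwise (All.lookup all⊆cl (∈-allFin _))))

  basis⇔independent×spans : ∀ {B} → IsBasis M B ⇔ (Independent M B × Spans M B)
  basis⇔independent×spans {B} = mk⇔
    (λ (indB , maximal) → indB ,
      (let J , B⊆J , _ , indJ , rJ≡rk = extend-within indB ⊆⊤
       in ≤-antisym (rank-⊆ ⊆⊤) (subst (_≤ R B) rJ≡rk (rank-⊆ (maximal J B⊆J indJ)))))
    (λ (indB , spB) → indB , λ Y B⊆Y indY → p⊆q∧∣q∣≤∣p∣⇒q⊆p B⊆Y (begin
      ∣ Y ∣  ≡⟨ sym indY ⟩
      R Y    ≤⟨ rank-⊆ ⊆⊤ ⟩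
      rk M   ≡⟨ sym spB ⟩
      R B    ≡⟨ indB ⟩
      ∣ B ∣  ∎))
    where open ≤-Reasoning

  ⊆basis⇔independent : ∀ {T} → (∃ λ B → IsBasis M B × T ⊆ B) ⇔ Independent M T
  ⊆basis⇔independent {T} = mk⇔ (λ (B , basisB , T⊆B) → independent-⊆ T⊆B (proj₁ basisB)) extend-to-basis
    where
    extend-to-basis : Independent M T → ∃ λ B → IsBasis M B × T ⊆ B
    extend-to-basis indT with extend-within indT ⊆⊤
    ... | J , T⊆J , _ , indJ , rJ≡rk = J , from basis⇔independent×spans (indJ , rJ≡rk) , T⊆J

  ⊇basis⇔spans : ∀ {S} → (∃ λ B → IsBasis M B × B ⊆ S) ⇔ Spans M S
  ⊇basis⇔spans {S} = mk⇔ spans basis-inside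
    where
    spans : (∃ λ B → IsBasis M B × B ⊆ S) → Spans M S
    spans (B , basisB , B⊆S) = ≤-antisym (rank-⊆ ⊆⊤)
      (subst (_≤ R S) (proj₂ (to basis⇔independent×spans basisB)) (rank-⊆ B⊆S))
    basis-inside : Spans M S → ∃ λ B → IsBasis M B × B ⊆ S
    basis-inside spS with extend-within independent-⊥ ⊥⊆
    ... | J , _ , J⊆S , indJ , rJ≡rS = J , from basis⇔independent×spans (indJ , trans rJ≡rS spS) , J⊆S

basisOf⇔independent×spans : ∀ {n m} {M : Matroid n} {M' : Matroid m} {φ : Fin n → Fin m} {T} →
  BasisOf M M' φ T ⇔ (Independent M T × Spans M' (image φ T))
basisOf⇔independent×spans {M = M} {M'} = ⊆basis⇔independent M ×-⇔ ⊇basis⇔spans M'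

rk-≤-of-spanning-image : ∀ {n m} {M : Matroid n} {M' : Matroid m} {φ : Fin n → Fin m} →
  IsMorphism M M' φ → Spans M' (image φ ⊤) → rk M' ≤ rk M
rk-≤-of-spanning-image {M = M} {M'} {φ} mor spφ = begin
  rk M'                                        ≡⟨ sym spφ ⟩
  rank M' (image φ ⊤)                          ≡⟨ sym (+-identityʳ _) ⟩
  rank M' (image φ ⊤) + 0                      ≡⟨ cong (_ +_) (sym (rank-⊥ M)) ⟩
  rank M' (image φ ⊤) + rank M ⊥               ≤⟨ mor ⊥ ⊤ ⊆⊤ ⟩
  rk M + rank M' (image φ ⊥)                   ≡⟨ cong (rk M +_) (n≤0⇒n≡0 rank-φ⊥≤0) ⟩
  rk M + 0                                     ≡⟨ +-identityʳ _ ⟩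
  rk M                                         ∎
  where
  open ≤-Reasoning
  rank-φ⊥≤0 : rank M' (image φ ⊥) ≤ 0
  rank-φ⊥≤0 = subst (rank M' (image φ ⊥) ≤_) (rank-⊥ M') (rank-⊆ M' (image-⊥ φ))

record Submodular {n} (h : Subset n → ℕ) : Set where
  constructor mkSubmodular
  field
    ∪+∩≤ : ∀ X Y → h (X ∪ Y) + h (X ∩ Y) ≤ h X + h Y

open Submodular

rank-submodular : ∀ {n} (M : Matroid n) → Submodular (rank M)
rank-submodular M = mkSubmodular (rank-submod M)

∣∣-submodular : ∀ {n} → Submodular {n} ∣_∣
∣∣-submodular = mkSubmodular λ X Y → ≤-reflexive (∣p∪q∣+∣p∩q∣≡∣p∣+∣q∣ X Y)

+-submodular : ∀ {n} {h₁ h₂ : Subset n → ℕ} → Submodular h₁ → Submodular h₂ → Submodular (λ X → h₁ X + h₂ X)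
+-submodular {h₁ = h₁} {h₂} sub₁ sub₂ = mkSubmodular λ X Y → begin
  (h₁ (X ∪ Y) + h₂ (X ∪ Y)) + (h₁ (X ∩ Y) + h₂ (X ∩ Y)) ≡⟨ interchange (h₁ (X ∪ Y)) _ _ _ ⟩
  (h₁ (X ∪ Y) + h₁ (X ∩ Y)) + (h₂ (X ∪ Y) + h₂ (X ∩ Y)) ≤⟨ +-mono-≤ (∪+∩≤ sub₁ X Y) (∪+∩≤ sub₂ X Y) ⟩
  (h₁ X + h₁ Y) + (h₂ X + h₂ Y)                         ≡⟨ interchange (h₁ X) (h₁ Y) (h₂ X) (h₂ Y) ⟩
  (h₁ X + h₂ X) + (h₁ Y + h₂ Y)                         ∎
  where open ≤-Reasoning

const+-submodular : ∀ {n} k {h : Subset n → ℕ} → Submodular h → Submodular (λ X → k + h X)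
const+-submodular k = +-submodular (mkSubmodular λ _ _ → ≤-refl)

∘take-submodular : ∀ r {n} {h : Subset r → ℕ} → Submodular h → Submodular {r + n} (λ X → h (take r X))
∘take-submodular r {h = h} sub = mkSubmodular λ X Y →
  subst₂ (λ U I → h U + h I ≤ h (take r X) + h (take r Y)) (sym (take-zipWith _∨_ X Y)) (sym (take-zipWith _∧_ X Y))
    (∪+∩≤ sub (take r X) (take r Y))

∘drop-submodular : ∀ r {n} {h : Subset n → ℕ} → Submodular h → Submodular {r + n} (λ X → h (drop r X))
∘drop-submodular r {h = h} sub = mkSubmodular λ X Y →
  subst₂ (λ U I → h U + h I ≤ h (drop r X) + h (drop r Y)) (sym (drop-zipWith _∨_ X Y)) (sym (drop-zipWith _∧_ X Y))
    (∪+∩≤ sub (drop r X) (drop r Y))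

rank∘image-submodular : ∀ {n m} (M' : Matroid m) (φ : Fin n → Fin m) → Submodular (λ X → rank M' (image φ X))
rank∘image-submodular M' φ = mkSubmodular λ X Y → begin
  rank M' (image φ (X ∪ Y)) + rank M' (image φ (X ∩ Y))
    ≤⟨ +-mono-≤ (rank-⊆ M' (image-∪ φ X Y)) (rank-⊆ M' (image-∩ φ X Y)) ⟩
  rank M' (image φ X ∪ image φ Y) + rank M' (image φ X ∩ image φ Y)
    ≤⟨ rank-submod M' (image φ X) (image φ Y) ⟩
  rank M' (image φ X) + rank M' (image φ Y)
    ∎
  where open ≤-Reasoning

exchange : ∀ u i x y a b → u + i ≤ x + y → a + x ≤ b + i → u + a ≤ b + y
exchange u i x y a b ui≤xy ax≤bi = +-cancelʳ-≤ (i + x) _ _ (begin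
  (u + a) + (i + x)  ≡⟨ interchange u a i x ⟩
  (u + i) + (a + x)  ≤⟨ +-mono-≤ ui≤xy ax≤bi ⟩
  (x + y) + (b + i)  ≡⟨ shuffle x y b i ⟩
  (b + y) + (i + x)  ∎)
  where
  open ≤-Reasoning
  shuffle : ∀ x y b i → (x + y) + (b + i) ≡ (b + y) + (i + x)
  shuffle = solve-∀

-- The third hypothesis is needed only in the mixed cases, where the min is attained by
-- different functions at X and at Y.
⊓-submodular : ∀ {k} {h₁ h₂ : Subset k → ℕ} → Submodular h₁ → Submodular h₂ →
  (∀ {X Y} → X ⊆ Y → h₁ X + h₂ Y ≤ h₁ Y + h₂ X) → Submodular (λ X → h₁ X ⊓ h₂ X)
⊓-submodular {h₁ = h₁} {h₂} sub₁ sub₂ slower = mkSubmodular bound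
  where
  open ≤-Reasoning
  bound : ∀ X Y → h₁ (X ∪ Y) ⊓ h₂ (X ∪ Y) + h₁ (X ∩ Y) ⊓ h₂ (X ∩ Y) ≤ h₁ X ⊓ h₂ X + h₁ Y ⊓ h₂ Y
  bound X Y with ≤-total (h₁ X) (h₂ X) | ≤-total (h₁ Y) (h₂ Y)
  ... | inj₁ X₁≤X₂ | inj₁ Y₁≤Y₂ = begin
    h₁ (X ∪ Y) ⊓ h₂ (X ∪ Y) + h₁ (X ∩ Y) ⊓ h₂ (X ∩ Y)  ≤⟨ +-mono-≤ (m⊓n≤m (h₁ (X ∪ Y)) (h₂ (X ∪ Y))) (m⊓n≤m (h₁ (X ∩ Y)) (h₂ (X ∩ Y))) ⟩
    h₁ (X ∪ Y) + h₁ (X ∩ Y)                            ≤⟨ ∪+∩≤ sub₁ X Y ⟩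
    h₁ X + h₁ Y                                        ≡⟨ cong₂ _+_ (m≤n⇒m⊓n≡m X₁≤X₂) (m≤n⇒m⊓n≡m Y₁≤Y₂) ⟨
    h₁ X ⊓ h₂ X + h₁ Y ⊓ h₂ Y                          ∎
  ... | inj₂ X₂≤X₁ | inj₂ Y₂≤Y₁ = begin
    h₁ (X ∪ Y) ⊓ h₂ (X ∪ Y) + h₁ (X ∩ Y) ⊓ h₂ (X ∩ Y)  ≤⟨ +-mono-≤ (m⊓n≤n (h₁ (X ∪ Y)) (h₂ (X ∪ Y))) (m⊓n≤n (h₁ (X ∩ Y)) (h₂ (X ∩ Y))) ⟩
    h₂ (X ∪ Y) + h₂ (X ∩ Y)                            ≤⟨ ∪+∩≤ sub₂ X Y ⟩
    h₂ X + h₂ Y                                        ≡⟨ cong₂ _+_ (m≥n⇒m⊓n≡n X₂≤X₁) (m≥n⇒m⊓n≡n Y₂≤Y₁) ⟨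
    h₁ X ⊓ h₂ X + h₁ Y ⊓ h₂ Y                          ∎
  ... | inj₁ X₁≤X₂ | inj₂ Y₂≤Y₁ = begin
    h₁ (X ∪ Y) ⊓ h₂ (X ∪ Y) + h₁ (X ∩ Y) ⊓ h₂ (X ∩ Y)  ≤⟨ +-mono-≤ (m⊓n≤n (h₁ (X ∪ Y)) (h₂ (X ∪ Y))) (m⊓n≤m (h₁ (X ∩ Y)) (h₂ (X ∩ Y))) ⟩
    h₂ (X ∪ Y) + h₁ (X ∩ Y)                            ≤⟨ exchange _ (h₂ (X ∩ Y)) (h₂ X) _ _ _
                                                            (∪+∩≤ sub₂ X Y) (slower (p∩q⊆p X Y)) ⟩
    h₁ X + h₂ Y                                        ≡⟨ cong₂ _+_ (m≤n⇒m⊓n≡m X₁≤X₂) (m≥n⇒m⊓n≡n Y₂≤Y₁) ⟨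
    h₁ X ⊓ h₂ X + h₁ Y ⊓ h₂ Y                          ∎
  ... | inj₂ X₂≤X₁ | inj₁ Y₁≤Y₂ = begin
    h₁ (X ∪ Y) ⊓ h₂ (X ∪ Y) + h₁ (X ∩ Y) ⊓ h₂ (X ∩ Y)  ≤⟨ +-mono-≤ (m⊓n≤n (h₁ (X ∪ Y)) (h₂ (X ∪ Y))) (m⊓n≤m (h₁ (X ∩ Y)) (h₂ (X ∩ Y))) ⟩
    h₂ (X ∪ Y) + h₁ (X ∩ Y)                            ≤⟨ exchange _ (h₂ (X ∩ Y)) (h₂ Y) _ _ _
                                                            (subst (h₂ (X ∪ Y) + h₂ (X ∩ Y) ≤_) (+-comm (h₂ X) (h₂ Y)) (∪+∩≤ sub₂ X Y))
                                                            (slower (p∩q⊆q X Y)) ⟩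
    h₁ Y + h₂ X                                        ≡⟨ +-comm (h₁ Y) (h₂ X) ⟩
    h₂ X + h₁ Y                                        ≡⟨ cong₂ _+_ (m≥n⇒m⊓n≡n X₂≤X₁) (m≤n⇒m⊓n≡m Y₁≤Y₂) ⟨
    h₁ X ⊓ h₂ X + h₁ Y ⊓ h₂ Y                          ∎

-- Q is encoded as the first r coordinates: take r X = X ∩ Q and drop r X = X ∩ F.
module FreeExtension {n m} (M : Matroid n) (M' : Matroid m) (φ : Fin n → Fin m)
  (mor : IsMorphism M M' φ) (spφ : Spans M' (image φ ⊤)) where

  r c K : ℕ
  r = rk M
  c = rk M'
  K = r ∸ c

  K+c≡r : K + c ≡ r
  K+c≡r = m∸n+n≡m (rk-≤-of-spanning-image {M = M} {M'} {φ} mor spφ)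

  ρ₁ ρ₂ ρ : Subset (r + n) → ℕ
  ρ₁ X = ∣ take r X ∣ + rank M (drop r X)
  ρ₂ X = K + rank M' (image φ (drop r X))
  ρ X = ρ₁ X ⊓ ρ₂ X

  ρ₂-grows-slower : ∀ {X Y} → X ⊆ Y → ρ₁ X + ρ₂ Y ≤ ρ₁ Y + ρ₂ X
  ρ₂-grows-slower {X} {Y} X⊆Y = begin
    (∣ Q∩X ∣ + rank M F∩X) + (K + rank M' φY)   ≡⟨ shuffleˡ ∣ Q∩X ∣ (rank M F∩X) K (rank M' φY) ⟩
    K + (∣ Q∩X ∣ + (rank M' φY + rank M F∩X))   ≤⟨ +-monoʳ-≤ K (+-mono-≤ (p⊆q⇒∣p∣≤∣q∣ (take-⊆ r X⊆Y)) (mor _ _ (drop-⊆ r X⊆Y))) ⟩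
    K + (∣ Q∩Y ∣ + (rank M F∩Y + rank M' φX))   ≡⟨ shuffleʳ ∣ Q∩Y ∣ (rank M F∩Y) K (rank M' φX) ⟨
    (∣ Q∩Y ∣ + rank M F∩Y) + (K + rank M' φX)   ∎
    where
    open ≤-Reasoning
    Q∩X = take r X
    Q∩Y = take r Y
    F∩X = drop r X
    F∩Y = drop r Y
    φX = image φ F∩X
    φY = image φ F∩Y
    shuffleˡ : ∀ a b k d → (a + b) + (k + d) ≡ k + (a + (d + b))
    shuffleˡ = solve-∀
    shuffleʳ : ∀ a b k d → (a + b) + (k + d) ≡ k + (a + (b + d))
    shuffleʳ = solve-∀

  N : Matroid (r + n)
  N = record
    { rank        = ρ
    ; rank-bound  = λ X → begin
        ρ X                                ≤⟨ m⊓n≤m (ρ₁ X) (ρ₂ X) ⟩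
        ∣ take r X ∣ + rank M (drop r X)   ≤⟨ +-monoʳ-≤ ∣ take r X ∣ (rank-bound M (drop r X)) ⟩
        ∣ take r X ∣ + ∣ drop r X ∣        ≡⟨ ∣p∣≡∣take∣+∣drop∣ r X ⟨
        ∣ X ∣                              ∎
    ; rank-mono   = λ X Y X⊆Y → ⊓-mono-≤
        (+-mono-≤ (p⊆q⇒∣p∣≤∣q∣ (take-⊆ r X⊆Y)) (rank-⊆ M (drop-⊆ r X⊆Y)))
        (+-monoʳ-≤ K (rank-⊆ M' (image-mono φ (drop-⊆ r X⊆Y))))
    ; rank-submod = ∪+∩≤ {h = ρ} (⊓-submodular
        (+-submodular (∘take-submodular r ∣∣-submodular) (∘drop-submodular r (rank-submodular M)))
        (const+-submodular K (∘drop-submodular r (rank∘image-submodular M' φ)))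
        ρ₂-grows-slower)
    }
    where open ≤-Reasoning

  ρ-⊤ : ρ ⊤ ≡ r
  ρ-⊤ = begin
    ρ₁ ⊤ ⊓ ρ₂ ⊤         ≡⟨ cong₂ _⊓_ ρ₁-⊤ ρ₂-⊤ ⟩
    (r + rk M) ⊓ r      ≡⟨ m≥n⇒m⊓n≡n (m≤m+n r (rk M)) ⟩
    r                   ∎
    where
    open ≡-Reasoning
    ρ₁-⊤ : ρ₁ ⊤ ≡ r + rk M
    ρ₁-⊤ rewrite take-⊤ r {n} | drop-⊤ r {n} = cong (_+ rk M) (∣⊤∣≡n r)
    ρ₂-⊤ : ρ₂ ⊤ ≡ r
    ρ₂-⊤ rewrite drop-⊤ r {n} | spφ = K+c≡r

  independent-N⇔ : ∀ {X} → Independent N X ⇔ (∣ X ∣ ≤ ρ₁ X × ∣ X ∣ ≤ ρ₂ X)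
  independent-N⇔ {X} = mk⇔
    (λ indX → subst (_≤ ρ₁ X) indX (m⊓n≤m (ρ₁ X) (ρ₂ X)) , subst (_≤ ρ₂ X) indX (m⊓n≤n (ρ₁ X) (ρ₂ X)))
    (λ (≤ρ₁ , ≤ρ₂) → ≤-antisym (rank-bound N X) (⊓-glb ≤ρ₁ ≤ρ₂))

  ≤ρ₁⇔independent : ∀ {X} → ∣ X ∣ ≤ ρ₁ X ⇔ Independent M (drop r X)
  ≤ρ₁⇔independent {X} = mk⇔
    (λ ≤ρ₁ → ≤-antisym (rank-bound M _)
      (+-cancelˡ-≤ ∣ take r X ∣ _ _ (subst (_≤ ρ₁ X) (∣p∣≡∣take∣+∣drop∣ r X) ≤ρ₁)))
    (λ indF∩X → ≤-reflexive (trans (∣p∣≡∣take∣+∣drop∣ r X) (cong (∣ take r X ∣ +_) (sym indF∩X))))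

  r≤ρ₂⇔spans : ∀ {X} → r ≤ ρ₂ X ⇔ Spans M' (image φ (drop r X))
  r≤ρ₂⇔spans {X} = mk⇔
    (λ r≤ρ₂ → ≤-antisym (rank-⊆ M' ⊆⊤) (+-cancelˡ-≤ K _ _ (subst (_≤ ρ₂ X) (sym K+c≡r) r≤ρ₂)))
    (λ spans → ≤-reflexive (trans (sym K+c≡r) (cong (K +_) (sym spans))))

  basis-N⇔ : ∀ B → IsBasis N B ⇔ (∣ B ∣ ≡ r × Independent M (drop r B) × Spans M' (image φ (drop r B)))
  basis-N⇔ B = mk⇔ basis⇒ ⇒basis
    where
    basis⇒ : IsBasis N B → ∣ B ∣ ≡ r × Independent M (drop r B) × Spans M' (image φ (drop r B))
    basis⇒ basisB with to (basis⇔independent×spans N) basisB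
    ... | indB , spB with to independent-N⇔ indB
    ...   | ≤ρ₁ , ≤ρ₂ = ∣B∣≡r , to ≤ρ₁⇔independent ≤ρ₁ , to r≤ρ₂⇔spans (subst (_≤ ρ₂ B) ∣B∣≡r ≤ρ₂)
      where ∣B∣≡r = trans (sym indB) (trans spB ρ-⊤)
    ⇒basis : ∣ B ∣ ≡ r × Independent M (drop r B) × Spans M' (image φ (drop r B)) → IsBasis N B
    ⇒basis (∣B∣≡r , indF∩B , spans) =
      from (basis⇔independent×spans N) (indB , trans indB (trans ∣B∣≡r (sym ρ-⊤)))
      where
      indB : Independent N B
      indB = from independent-N⇔
        (from ≤ρ₁⇔independent indF∩B , subst (_≤ ρ₂ B) (sym ∣B∣≡r) (from r≤ρ₂⇔spans spans))

proposition3p6 : ∀ {n m} (M : Matroid n) (M' : Matroid m) (φ : Fin n → Fin m)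
    → IsMorphism M M' φ
    → Spans M' (image φ ⊤)
    → Σ[ N ∈ Matroid (rk M + n) ]
    (∀ B → IsBasis N B ⇔ (∣ B ∣ ≡ rk M × BasisOf M M' φ (drop (rk M) B)))
proposition3p6 M M' φ mor spφ = N , λ B →
  ⇔.trans (basis-N⇔ B) (⇔.refl ×-⇔ ⇔.sym (basisOf⇔independent×spans {M = M} {M'} {φ}))
  where
  open FreeExtension M M' φ mor spφ
  module ⇔ = IsEquivalence ⇔-isEquivalence
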